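{- Let $q$ be a power of an odd prime, let $h_k(X)=1+X+\cdots+X^k\in\mathbb{F}_q[X]$ and $E=\mathbb{F}_q\setminus\{0,1\}$. If $1<k<q-1$ and $\gcd(k,q-1)=1$, then there exist distinct $c_1,c_2\in E$ such that $h_k(c_1)=h_k(c_2)$. -}

module Defs where

open import Level using (Level; _⊔_)
open import Data.Nat using (ℕ; zero; suc)
open import Data.Fin using (Fin)
open import Data.Product using (Σ; ∃)
open import Relation.Nullary using (¬_)
open import Relation.Binary.PropositionalEquality using (_≡_)
open import Algebra.Bundles using (CommutativeRing)

record FiniteField (c ℓ : Level) (q : ℕ) : Set (Level.suc (c ⊔ ℓ)) where
  field
    commRing : CommutativeRing c ℓ
  open CommutativeRing commRing public
  field
    0≉1     : ¬ (0# ≈ 1#)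
    inverse : ∀ x → ¬ (x ≈ 0#) → ∃ λ y → x * y ≈ 1#
    enum    : Fin q → Carrier
    enum-injective  : ∀ i j → enum i ≈ enum j → i ≡ j
    enum-surjective : ∀ x → ∃ λ i → enum i ≈ x

  pow : Carrier → ℕ → Carrier
  pow x zero    = 1#
  pow x (suc n) = x * pow x n

  h : ℕ → Carrier → Carrier
  h zero    x = 1#
  h (suc k) x = h k x + pow x (suc k)

-- Suppose h = h_k were injective on E = F ∖ {0, 1}.  Since x ↦ x^k is a
-- bijection (gcd (k, q - 1) = 1) and (h x - 1)(x - 1) = (x^k - 1) x, also
-- h x ≠ 1 = h 0 on E, so h is injective on F ∖ {1} and becomes a permutation σ
-- of F once 1 is sent to the value v that h misses.  For a permutation τ of F
-- and a constant c, the nonzero values of τ - c are exactly the nonzero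
-- elements, so their product W does not depend on τ; hence an identity between
-- products of such factors holding off a finite set D yields an identity
-- between their finitely many values on D.  For D = {0, 1} and
-- (σ y - 1)(y - 1) = (y^k - 1) y this gives v = 2.  For a ∈ E, with s = a^k,
-- m = h a and the permutation G y = s σ (y / a), the identity
-- (h y - 1)(y^k - s)(G y - m) = (h y - m)(y^k - 1)(G y - s) off {0, 1, a}
-- gives 2 m = 2 (1 + s), so m = 1 + s as q is odd, and then a^k = a.  Thus
-- every nonzero x is a root of x^(k-1) - 1, which is impossible for k < q - 1.

{-# OPTIONS --safe #-}
module Submission where

open import Defs
open import Level using (Level; 0ℓ; _⊔_)
open import Function using (_∘_; id)
open import Function.Definitions using (Congruent; Injective)
open import Data.Nat as ℕ using (ℕ; zero; suc; _∸_; _^_; _<_)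
open import Data.Nat.DivMod using (_%_; _/_; m%n<n; %-distribˡ-*; m≡m%n+[m/n]*n)
open import Data.Nat.Divisibility using (m%n≡0⇒n∣m)
open import Data.Nat.Primality using (Prime; prime⇒irreducible)
import Data.Nat.Properties as ℕ
open import Data.Nat.GCD using (gcd; GCD; gcd-GCD; module Bézout)
open import Data.Fin as Fin using (Fin; punchIn; punchOut)
import Data.Fin.Properties as Fin
open import Data.Fin.Permutation using (permutation)
open import Data.Product using (_×_; _,_; proj₁; proj₂; ∃; ∃₂)
open import Data.Sum using (inj₁; inj₂)
open import Data.Maybe using (Maybe; just; nothing)
open import Data.List as List using (List; []; _∷_)
open import Data.List.Relation.Unary.Any as Any using (Any; here; there)
open import Data.List.Relation.Unary.All.Properties using (All¬⇒¬Any)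
open import Data.List.Relation.Unary.All using (_∷_; [])
open import Data.List.Relation.Unary.AllPairs using (_∷_; [])
open import Data.List.Relation.Binary.Pointwise using (Pointwise; []; _∷_)
open import Relation.Nullary using (¬_; yes; no; Dec; contradiction)
open import Relation.Nullary.Decidable using (map′; ¬?; decidable-stable)
open import Relation.Binary.PropositionalEquality as ≡ using (_≡_; _≢_)
open import Relation.Binary.Bundles using (DecSetoid)
import Algebra.Properties.CommutativeMonoid.Sum
open import Algebra.Bundles using (CommutativeRing; CommutativeMonoid; RawRing)
open import Algebra.Solver.Ring.AlmostCommutativeRing
  using (fromCommutativeRing; _-Raw-AlmostCommutative⟶_)

module IntegerCoefficientSolver {c ℓ : Level} (R : CommutativeRing c ℓ) where
  open CommutativeRing R
  open import Algebra.Properties.Semiring.Mult.TCOptimised semiring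
    using (×-homo-+; ×1-homo-*; ×-cong) renaming (_×_ to _·_)
  open import Algebra.Properties.AbelianGroup +-abelianGroup using (⁻¹-anti-homo‿-; ⁻¹-∙-comm)
  open import Algebra.Properties.CommutativeSemigroup +-commutativeSemigroup using (interchange)
  open import Algebra.Properties.Ring ring using (-‿distribˡ-*; -‿distribʳ-*; -‿involutive; -0#≈0#)
  open import Relation.Binary.Reasoning.Setoid setoid

  -- (a , b) stands for a - b; coefficients are kept normalised (one component
  -- zero) so that the normal forms the solver compares are equal by computation.
  ℤ₂ : Set
  ℤ₂ = ℕ × ℕ

  _⊖_ : ℕ → ℕ → ℤ₂
  a ⊖ b = a ∸ b , b ∸ a

  coefficients : RawRing 0ℓ 0ℓ
  coefficients = record
    { Carrier = ℤ₂
    ; _≈_     = _≡_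
    ; _+_     = λ (a , b) (c , d) → (a ℕ.+ c) ⊖ (b ℕ.+ d)
    ; _*_     = λ (a , b) (c , d) → (a ℕ.* c ℕ.+ b ℕ.* d) ⊖ (a ℕ.* d ℕ.+ b ℕ.* c)
    ; -_      = λ (a , b) → b , a
    ; 0#      = 0 , 0
    ; 1#      = 1 , 0
    }

  -- The first clause makes con (1 , 0) and con (2 , 0) denote 1# and 1# + 1# exactly.
  ⟦_⟧ᶜ : ℤ₂ → Carrier
  ⟦ a , zero  ⟧ᶜ = a · 1#
  ⟦ a , suc b ⟧ᶜ = a · 1# - suc b · 1#

  x-0≈x : ∀ x → x - 0# ≈ x
  x-0≈x x = trans (+-congˡ -0#≈0#) (+-identityʳ x)

  [x+y]-[z+w]≈[x-z]+[y-w] : ∀ x y z w → (x + y) - (z + w) ≈ (x - z) + (y - w)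
  [x+y]-[z+w]≈[x-z]+[y-w] x y z w = begin
    (x + y) - (z + w)      ≈⟨ +-congˡ (⁻¹-∙-comm z w) ⟨
    (x + y) + (- z + - w)  ≈⟨ interchange x y (- z) (- w) ⟩
    (x - z) + (y - w)      ∎

  [x+z]-[y+z]≈x-y : ∀ x y z → (x + z) - (y + z) ≈ x - y
  [x+z]-[y+z]≈x-y x y z = begin
    (x + z) - (y + z)  ≈⟨ [x+y]-[z+w]≈[x-z]+[y-w] x z y z ⟩
    (x - y) + (z - z)  ≈⟨ +-congˡ (-‿inverseʳ z) ⟩
    (x - y) + 0#       ≈⟨ +-identityʳ (x - y) ⟩
    x - y              ∎

  x+w≈z+y⇒x-y≈z-w : ∀ {x y z w} → x + w ≈ z + y → x - y ≈ z - w
  x+w≈z+y⇒x-y≈z-w {x} {y} {z} {w} eq = begin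
    x - y              ≈⟨ [x+z]-[y+z]≈x-y x y w ⟨
    (x + w) - (y + w)  ≈⟨ +-cong eq (-‿cong (+-comm y w)) ⟩
    (z + y) - (w + y)  ≈⟨ [x+z]-[y+z]≈x-y z w y ⟩
    z - w              ∎

  [xz+yw]-[xw+yz]≈[x-y][z-w] : ∀ x y z w → (x * z + y * w) - (x * w + y * z) ≈ (x - y) * (z - w)
  [xz+yw]-[xw+yz]≈[x-y][z-w] x y z w = sym (begin
    (x - y) * (z - w)                            ≈⟨ distribʳ (z - w) x (- y) ⟩
    x * (z - w) + - y * (z - w)                  ≈⟨ +-cong (distribˡ x z (- w)) (distribˡ (- y) z (- w)) ⟩
    (x * z + x * - w) + (- y * z + - y * - w)    ≈⟨ +-cong (+-congˡ (-‿distribʳ-* x w)) (+-cong (-‿distribˡ-* y z) (-‿distribˡ-* y (- w))) ⟨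
    (x * z - x * w) + (- (y * z) + - (y * - w))  ≈⟨ +-congˡ (+-congˡ (-‿cong (-‿distribʳ-* y w))) ⟨
    (x * z - x * w) + (- (y * z) + - - (y * w))  ≈⟨ +-congˡ (+-congˡ (-‿involutive (y * w))) ⟩
    (x * z - x * w) + (- (y * z) + y * w)        ≈⟨ +-congˡ (+-comm (- (y * z)) (y * w)) ⟩
    (x * z - x * w) + (y * w - y * z)            ≈⟨ [x+y]-[z+w]≈[x-z]+[y-w] (x * z) (y * w) (x * w) (y * z) ⟨
    (x * z + y * w) - (x * w + y * z)            ∎)

  ⟦⟧-difference : ∀ a b → ⟦ a , b ⟧ᶜ ≈ a · 1# - b · 1#
  ⟦⟧-difference a zero    = sym (x-0≈x (a · 1#))
  ⟦⟧-difference a (suc b) = refl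

  ⊖-difference : ∀ a b → (a ∸ b) · 1# - (b ∸ a) · 1# ≈ a · 1# - b · 1#
  ⊖-difference zero    zero    = refl
  ⊖-difference zero    (suc b) = refl
  ⊖-difference (suc a) zero    = refl
  ⊖-difference (suc a) (suc b) = begin
    (a ∸ b) · 1# - (b ∸ a) · 1#            ≈⟨ ⊖-difference a b ⟩
    a · 1# - b · 1#                        ≈⟨ [x+z]-[y+z]≈x-y (a · 1#) (b · 1#) 1# ⟨
    (a · 1# + 1#) - (b · 1# + 1#)          ≈⟨ +-cong (×-homo-+ 1# a 1) (-‿cong (×-homo-+ 1# b 1)) ⟨
    (a ℕ.+ 1) · 1# - (b ℕ.+ 1) · 1#        ≈⟨ +-cong (×-cong (ℕ.+-comm a 1) refl) (-‿cong (×-cong (ℕ.+-comm b 1) refl)) ⟩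
    suc a · 1# - suc b · 1#                ∎

  ⟦⊖⟧ : ∀ a b → ⟦ a ⊖ b ⟧ᶜ ≈ a · 1# - b · 1#
  ⟦⊖⟧ a b = trans (⟦⟧-difference (a ∸ b) (b ∸ a)) (⊖-difference a b)

  homomorphism : coefficients -Raw-AlmostCommutative⟶ fromCommutativeRing R
  homomorphism = record
    { ⟦_⟧    = ⟦_⟧ᶜ
    ; +-homo = λ (a , b) (c , d) → begin
        ⟦ (a ℕ.+ c) ⊖ (b ℕ.+ d) ⟧ᶜ             ≈⟨ ⟦⊖⟧ (a ℕ.+ c) (b ℕ.+ d) ⟩
        (a ℕ.+ c) · 1# - (b ℕ.+ d) · 1#        ≈⟨ +-cong (×-homo-+ 1# a c) (-‿cong (×-homo-+ 1# b d)) ⟩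
        (a · 1# + c · 1#) - (b · 1# + d · 1#)  ≈⟨ [x+y]-[z+w]≈[x-z]+[y-w] _ _ _ _ ⟩
        (a · 1# - b · 1#) + (c · 1# - d · 1#)  ≈⟨ +-cong (⟦⟧-difference a b) (⟦⟧-difference c d) ⟨
        ⟦ a , b ⟧ᶜ + ⟦ c , d ⟧ᶜ                ∎
    ; *-homo = λ (a , b) (c , d) → begin
        ⟦ (a ℕ.* c ℕ.+ b ℕ.* d) ⊖ (a ℕ.* d ℕ.+ b ℕ.* c) ⟧ᶜ
          ≈⟨ ⟦⊖⟧ (a ℕ.* c ℕ.+ b ℕ.* d) (a ℕ.* d ℕ.+ b ℕ.* c) ⟩
        (a ℕ.* c ℕ.+ b ℕ.* d) · 1# - (a ℕ.* d ℕ.+ b ℕ.* c) · 1#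
          ≈⟨ +-cong (·-homo-*+* a c b d) (-‿cong (·-homo-*+* a d b c)) ⟩
        (a · 1# * c · 1# + b · 1# * d · 1#) - (a · 1# * d · 1# + b · 1# * c · 1#)
          ≈⟨ [xz+yw]-[xw+yz]≈[x-y][z-w] _ _ _ _ ⟩
        (a · 1# - b · 1#) * (c · 1# - d · 1#)
          ≈⟨ *-cong (⟦⟧-difference a b) (⟦⟧-difference c d) ⟨
        ⟦ a , b ⟧ᶜ * ⟦ c , d ⟧ᶜ
          ∎
    ; -‿homo = λ (a , b) → begin
        ⟦ b , a ⟧ᶜ           ≈⟨ ⟦⟧-difference b a ⟩
        b · 1# - a · 1#      ≈⟨ ⁻¹-anti-homo‿- (a · 1#) (b · 1#) ⟨
        - (a · 1# - b · 1#)  ≈⟨ -‿cong (⟦⟧-difference a b) ⟨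
        - ⟦ a , b ⟧ᶜ         ∎
    ; 0-homo = refl
    ; 1-homo = refl
    }
    where
    ·-homo-*+* : ∀ a b c d → (a ℕ.* b ℕ.+ c ℕ.* d) · 1# ≈ a · 1# * b · 1# + c · 1# * d · 1#
    ·-homo-*+* a b c d = trans (×-homo-+ 1# (a ℕ.* b) (c ℕ.* d)) (+-cong (×1-homo-* a b) (×1-homo-* c d))

  _≟-coefficient_ : ∀ x y → Maybe (⟦ x ⟧ᶜ ≈ ⟦ y ⟧ᶜ)
  (a , b) ≟-coefficient (c , d) with a ℕ.+ d ℕ.≟ c ℕ.+ b
  ... | no _  = nothing
  ... | yes e = just (begin
    ⟦ a , b ⟧ᶜ       ≈⟨ ⟦⟧-difference a b ⟩
    a · 1# - b · 1#  ≈⟨ x+w≈z+y⇒x-y≈z-w a+d≈c+b ⟩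
    c · 1# - d · 1#  ≈⟨ ⟦⟧-difference c d ⟨
    ⟦ c , d ⟧ᶜ       ∎)
    where
    a+d≈c+b : a · 1# + d · 1# ≈ c · 1# + b · 1#
    a+d≈c+b = trans (sym (×-homo-+ 1# a d)) (trans (×-cong e refl) (×-homo-+ 1# c b))

  open import Algebra.Solver.Ring coefficients (fromCommutativeRing R) homomorphism _≟-coefficient_ public

injective⇒surjective : ∀ {m} {f : Fin m → Fin m} → Injective _≡_ _≡_ f → ∀ i → ∃ λ j → f j ≡ i
injective⇒surjective {suc m} {f} f-injective i with Fin.any? (λ j → f j Fin.≟ i)
... | yes hit = hit
... | no  miss = contradiction (Fin.injective⇒≤ punchOut∘f-injective) ℕ.1+n≰n
  where
  i≢f : ∀ j → i ≢ f j
  i≢f j i≡fj = miss (j , ≡.sym i≡fj)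
  punchOut∘f-injective : Injective _≡_ _≡_ (λ j → punchOut (i≢f j))
  punchOut∘f-injective eq = f-injective (Fin.punchOut-injective (i≢f _) (i≢f _) eq)

injective⇒missing : ∀ {m} {f : Fin m → Fin (suc m)} → Injective _≡_ _≡_ f → ∃ λ i → ∀ j → f j ≢ i
injective⇒missing {m} {f} f-injective with Fin.any? (λ i → Fin.all? (λ j → ¬? (f j Fin.≟ i)))
... | yes found = found
... | no  none  = contradiction (Fin.injective⇒≤ preimage-injective) ℕ.1+n≰n
  where
  preimage : ∀ i → ∃ λ j → f j ≡ i
  preimage i with Fin.¬∀⟶∃¬ m _ (λ j → ¬? (f j Fin.≟ i)) (λ miss → none (i , miss))
  ... | j , ¬f≢i = j , decidable-stable (f j Fin.≟ i) ¬f≢i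
  preimage-injective : Injective _≡_ _≡_ (proj₁ ∘ preimage)
  preimage-injective {i} {i′} eq =
    ≡.trans (≡.sym (proj₂ (preimage i))) (≡.trans (≡.cong f eq) (proj₂ (preimage i′)))

module _ {a ℓ : Level} (M : CommutativeMonoid a ℓ) where
  open CommutativeMonoid M
  open import Algebra.Properties.CommutativeMonoid.Sum M using (sum; sum-permute)

  sum-reindex : ∀ {m} {φ : Fin m → Fin m} → Injective _≡_ _≡_ φ → (f : Fin m → Carrier) →
                sum (f ∘ φ) ≈ sum f
  sum-reindex {m} {φ} φ-injective f = sym (sum-permute f (permutation φ φ⁻¹ φφ⁻¹≡id φ⁻¹φ≡id))
    where
    φ⁻¹ : Fin m → Fin m
    φ⁻¹ = proj₁ ∘ injective⇒surjective φ-injective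
    φφ⁻¹≡id : ∀ i → φ (φ⁻¹ i) ≡ i
    φφ⁻¹≡id = proj₂ ∘ injective⇒surjective φ-injective
    φ⁻¹φ≡id : ∀ i → φ⁻¹ (φ i) ≡ i
    φ⁻¹φ≡id i = φ-injective (φφ⁻¹≡id (φ i))

odd-prime : ∀ {p} → Prime p → p ≢ 2 → p % 2 ≡ 1
odd-prime {p} p-prime p≢2 with p % 2 in p%2≡0 | m%n<n p 2
... | 0 | _ with prime⇒irreducible p-prime (m%n≡0⇒n∣m p 2 p%2≡0)
...   | inj₁ ()
...   | inj₂ 2≡p = contradiction (≡.sym 2≡p) p≢2
odd-prime _ _ | 1           | _                  = ≡.refl
odd-prime _ _ | suc (suc _) | ℕ.s≤s (ℕ.s≤s ())

^-odd : ∀ {p} e → p % 2 ≡ 1 → p ^ e % 2 ≡ 1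
^-odd     zero    _     = ≡.refl
^-odd {p} (suc e) p%2≡1 = ≡.trans (%-distribˡ-* p (p ^ e) 2) (≡.cong₂ (λ a b → a ℕ.* b % 2) p%2≡1 (^-odd e p%2≡1))

odd⇒pred-even : ∀ {n} → suc n % 2 ≡ 1 → n ≡ (suc n / 2) ℕ.* 2
odd⇒pred-even {n} odd = ℕ.suc-injective (≡.trans (m≡m%n+[m/n]*n (suc n) 2) (≡.cong (ℕ._+ (suc n / 2) ℕ.* 2) odd))

module FiniteFieldProperties {c ℓ : Level} {n : ℕ} (F : FiniteField c ℓ (suc n)) where
  open FiniteField F
  open IntegerCoefficientSolver commRing public
    using (solve; _:=_; _:+_; _:*_; _:-_; con; Polynomial)
  open import Algebra.Properties.Group +-group
    using (x∙y⁻¹≈ε⇒x≈y; x≈y⇒x∙y⁻¹≈ε; identityʳ-unique) renaming (∙-cancelʳ to +-cancelʳ)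
  open import Relation.Binary.Reasoning.Setoid setoid

  ı ⅱ : ∀ {m} → Polynomial m
  ı = con (1 , 0)
  ⅱ = con (2 , 0)

  two : Carrier
  two = 1# + 1#

  index : Carrier → Fin (suc n)
  index x = proj₁ (enum-surjective x)

  enum∘index : ∀ x → enum (index x) ≈ x
  enum∘index x = proj₂ (enum-surjective x)

  index-injective : ∀ {x y} → index x ≡ index y → x ≈ y
  index-injective {x} {y} eq = trans (sym (enum∘index x)) (trans (reflexive (≡.cong enum eq)) (enum∘index y))

  index-cong : ∀ {x y} → x ≈ y → index x ≡ index y
  index-cong {x} {y} x≈y = enum-injective _ _ (trans (enum∘index x) (trans x≈y (sym (enum∘index y))))

  enum-punchIn≉ : ∀ u j → enum (punchIn (index u) j) ≉ u
  enum-punchIn≉ u j e = Fin.punchInᵢ≢i (index u) j (enum-injective _ _ (trans e (sym (enum∘index u))))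

  infix 4 _≟_
  _≟_ : ∀ x y → Dec (x ≈ y)
  x ≟ y = map′ index-injective index-cong (index x Fin.≟ index y)

  ∃₂? : ∀ {p} {P : Carrier → Carrier → Set p} →
        (∀ {x x′ y y′} → x ≈ x′ → y ≈ y′ → P x y → P x′ y′) → (∀ x y → Dec (P x y)) → Dec (∃₂ P)
  ∃₂? resp P? = map′ (λ (i , j , p) → enum i , enum j , p)
                     (λ (x , y , p) → index x , index y , resp (sym (enum∘index x)) (sym (enum∘index y)) p)
                     (Fin.any? λ i → Fin.any? λ j → P? (enum i) (enum j))

  module ExtendInjective {f : Carrier → Carrier} (u : Carrier) (f-cong : Congruent _≈_ _≈_ f)
                         (f-injective : ∀ {x y} → x ≉ u → y ≉ u → f x ≈ f y → x ≈ y) where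

    ψ : Fin n → Fin (suc n)
    ψ j = index (f (enum (punchIn (index u) j)))

    ψ-injective : Injective _≡_ _≡_ ψ
    ψ-injective {j} {j′} eq = Fin.punchIn-injective (index u) j j′ (enum-injective _ _
      (f-injective (enum-punchIn≉ u j) (enum-punchIn≉ u j′) (index-injective eq)))

    v : Carrier
    v = enum (proj₁ (injective⇒missing ψ-injective))

    f≉v : ∀ {y} → y ≉ u → f y ≉ v
    f≉v {y} y≉u fy≈v = proj₂ (injective⇒missing ψ-injective) j
      (≡.trans (index-cong fj≈v) (enum-injective _ _ (enum∘index v)))
      where
      iu≢iy : index u ≢ index y
      iu≢iy eq = y≉u (index-injective (≡.sym eq))
      j : Fin n
      j = punchOut iu≢iy
      fj≈v : f (enum (punchIn (index u) j)) ≈ v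
      fj≈v = trans (f-cong (trans (reflexive (≡.cong enum (Fin.punchIn-punchOut iu≢iy))) (enum∘index y))) fy≈v

    σ : Carrier → Carrier
    σ y with y ≟ u
    ... | yes _ = v
    ... | no  _ = f y

    σ-u : ∀ {y} → y ≈ u → σ y ≈ v
    σ-u {y} y≈u with y ≟ u
    ... | yes _   = refl
    ... | no  y≉u = contradiction y≈u y≉u

    σ≈f : ∀ {y} → y ≉ u → σ y ≈ f y
    σ≈f {y} y≉u with y ≟ u
    ... | yes y≈u = contradiction y≈u y≉u
    ... | no  _   = refl

    σ-cong : Congruent _≈_ _≈_ σ
    σ-cong {x} {y} x≈y = by-cases (x ≟ u)
      where
      by-cases : Dec (x ≈ u) → σ x ≈ σ y
      by-cases (yes x≈u) = trans (σ-u x≈u) (sym (σ-u (trans (sym x≈y) x≈u)))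
      by-cases (no  x≉u) = trans (σ≈f x≉u) (trans (f-cong x≈y) (sym (σ≈f (x≉u ∘ trans x≈y))))

    σ-injective : Injective _≈_ _≈_ σ
    σ-injective {x} {y} σx≈σy = by-cases (x ≟ u) (y ≟ u)
      where
      by-cases : Dec (x ≈ u) → Dec (y ≈ u) → x ≈ y
      by-cases (yes x≈u) (yes y≈u) = trans x≈u (sym y≈u)
      by-cases (yes x≈u) (no  y≉u) = contradiction (trans (sym (σ≈f y≉u)) (trans (sym σx≈σy) (σ-u x≈u))) (f≉v y≉u)
      by-cases (no  x≉u) (yes y≈u) = contradiction (trans (sym (σ≈f x≉u)) (trans σx≈σy (σ-u y≈u))) (f≉v x≉u)
      by-cases (no  x≉u) (no  y≉u) = f-injective x≉u y≉u (trans (sym (σ≈f x≉u)) (trans σx≈σy (σ≈f y≉u)))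

  1≉0 : 1# ≉ 0#
  1≉0 = 0≉1 ∘ sym

  x-y≈0⇒x≈y : ∀ {x y} → x - y ≈ 0# → x ≈ y
  x-y≈0⇒x≈y = x∙y⁻¹≈ε⇒x≈y _ _

  x≈y⇒x-y≈0 : ∀ {x y} → x ≈ y → x - y ≈ 0#
  x≈y⇒x-y≈0 = x≈y⇒x∙y⁻¹≈ε

  x≉y⇒x-y≉0 : ∀ {x y} → x ≉ y → x - y ≉ 0#
  x≉y⇒x-y≉0 x≉y = x≉y ∘ x-y≈0⇒x≈y

  minus-injective : ∀ c → Injective _≈_ _≈_ (λ x → x - c)
  minus-injective c {x} {y} = +-cancelʳ (- c) x y

  *-cancelˡ : ∀ {x y z} → x ≉ 0# → x * y ≈ x * z → y ≈ z
  *-cancelˡ {x} {y} {z} x≉0 eq with inverse x x≉0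
  ... | x⁻¹ , xx⁻¹≈1 = begin
    y              ≈⟨ *-identityˡ y ⟨
    1# * y         ≈⟨ *-congʳ xx⁻¹≈1 ⟨
    (x * x⁻¹) * y  ≈⟨ solve 3 (λ x x⁻¹ y → (x :* x⁻¹) :* y := x⁻¹ :* (x :* y)) refl x x⁻¹ y ⟩
    x⁻¹ * (x * y)  ≈⟨ *-congˡ eq ⟩
    x⁻¹ * (x * z)  ≈⟨ solve 3 (λ x x⁻¹ z → x⁻¹ :* (x :* z) := (x :* x⁻¹) :* z) refl x x⁻¹ z ⟩
    (x * x⁻¹) * z  ≈⟨ *-congʳ xx⁻¹≈1 ⟩
    1# * z         ≈⟨ *-identityˡ z ⟩
    z              ∎

  two≉1 : two ≉ 1#
  two≉1 two≈1 = 1≉0 (begin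
    1#         ≈⟨ solve 0 (ı := ⅱ :- ı) refl ⟩
    two - 1#   ≈⟨ x≈y⇒x-y≈0 two≈1 ⟩
    0#         ∎)

  *-cancelʳ : ∀ {x y z} → x ≉ 0# → y * x ≈ z * x → y ≈ z
  *-cancelʳ {x} {y} {z} x≉0 eq = *-cancelˡ x≉0 (trans (*-comm x y) (trans eq (*-comm z x)))

  *-nonzero : ∀ {x y} → x ≉ 0# → y ≉ 0# → x * y ≉ 0#
  *-nonzero {x} x≉0 y≉0 xy≈0 = y≉0 (*-cancelˡ x≉0 (trans xy≈0 (sym (zeroʳ x))))

  factor-* : ∀ {Y N X Y′ N′ X′} → Y ≈ N * X → Y′ ≈ N′ * X′ → Y * Y′ ≈ (N * N′) * (X * X′)
  factor-* {Y} {N} {X} {Y′} {N′} {X′} Y≈NX Y′≈N′X′ =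
    trans (*-cong Y≈NX Y′≈N′X′) (solve 4 (λ N X N′ X′ → (N :* X) :* (N′ :* X′) := (N :* N′) :* (X :* X′)) refl N X N′ X′)

  balance : ∀ {Y N X N′ X′} → Y ≉ 0# → Y ≈ N * X → Y ≈ N′ * X′ → X ≈ X′ → N ≈ N′
  balance {Y} {N} {X} {N′} {X′} Y≉0 Y≈NX Y≈N′X′ X≈X′ =
    *-cancelʳ X≉0 (trans (sym Y≈NX) (trans Y≈N′X′ (*-congˡ (sym X≈X′))))
    where
    X≉0 : X ≉ 0#
    X≉0 X≈0 = Y≉0 (trans Y≈NX (trans (*-congˡ X≈0) (zeroʳ N)))

  pow-cong : ∀ {x y} m → x ≈ y → pow x m ≈ pow y m
  pow-cong zero    x≈y = refl
  pow-cong (suc m) x≈y = *-cong x≈y (pow-cong m x≈y)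

  pow-+ : ∀ x a b → pow x (a ℕ.+ b) ≈ pow x a * pow x b
  pow-+ x zero    b = sym (*-identityˡ _)
  pow-+ x (suc a) b = trans (*-congˡ (pow-+ x a b)) (sym (*-assoc _ _ _))

  pow-* : ∀ x a b → pow x (a ℕ.* b) ≈ pow (pow x b) a
  pow-* x zero    b = refl
  pow-* x (suc a) b = trans (pow-+ x b (a ℕ.* b)) (*-congˡ (pow-* x a b))

  pow-distrib-* : ∀ x y m → pow (x * y) m ≈ pow x m * pow y m
  pow-distrib-* x y zero    = sym (*-identityˡ 1#)
  pow-distrib-* x y (suc m) = trans (*-congˡ (pow-distrib-* x y m))
    (solve 4 (λ x y a b → (x :* y) :* (a :* b) := (x :* a) :* (y :* b)) refl x y (pow x m) (pow y m))

  pow-1# : ∀ m → pow 1# m ≈ 1#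
  pow-1# zero    = refl
  pow-1# (suc m) = trans (*-identityˡ _) (pow-1# m)

  pow-nonzero : ∀ {x} m → x ≉ 0# → pow x m ≉ 0#
  pow-nonzero zero    x≉0 = 1≉0
  pow-nonzero (suc m) x≉0 = *-nonzero x≉0 (pow-nonzero m x≉0)

  pow-zero : ∀ {x} k → x ≈ 0# → pow x (suc k) ≈ 0#
  pow-zero k x≈0 = trans (*-congʳ x≈0) (zeroˡ _)

  injective-pow-0# : ∀ k → Injective _≈_ _≈_ (λ x → pow x k) → pow 0# k ≈ 0#
  injective-pow-0# zero    pow-injective′ = contradiction (pow-injective′ refl) 0≉1
  injective-pow-0# (suc k) _              = zeroˡ _

  module Fin∏ = Algebra.Properties.CommutativeMonoid.Sum *-commutativeMonoid

  ∏ : (Carrier → Carrier) → Carrier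
  ∏ f = Fin∏.sum (f ∘ enum)

  ∏-cong : ∀ {f g} → (∀ x → f x ≈ g x) → ∏ f ≈ ∏ g
  ∏-cong f≈g = Fin∏.sum-cong-≋ (f≈g ∘ enum)

  ∏-* : ∀ f g → ∏ (λ x → f x * g x) ≈ ∏ f * ∏ g
  ∏-* f g = Fin∏.∑-distrib-+ (f ∘ enum) (g ∘ enum)

  ∏-const : ∀ x → ∏ (λ _ → x) ≈ pow x (suc n)
  ∏-const x = sum-const (suc n)
    where
    sum-const : ∀ m → Fin∏.sum {m} (λ _ → x) ≈ pow x m
    sum-const zero    = refl
    sum-const (suc m) = *-congˡ (sum-const m)

  ∏-nonzero : ∀ {f} → (∀ x → f x ≉ 0#) → ∏ f ≉ 0#
  ∏-nonzero {f} f≉0 = sum-nonzero (f≉0 ∘ enum)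
    where
    sum-nonzero : ∀ {m} {t : Fin m → Carrier} → (∀ i → t i ≉ 0#) → Fin∏.sum t ≉ 0#
    sum-nonzero {zero}  t≉0 = 1≉0
    sum-nonzero {suc m} t≉0 = *-nonzero (t≉0 Fin.zero) (sum-nonzero (t≉0 ∘ Fin.suc))

  ∏-reindex : ∀ {f τ} → Congruent _≈_ _≈_ f → Injective _≈_ _≈_ τ → ∏ (f ∘ τ) ≈ ∏ f
  ∏-reindex {f} {τ} f-cong τ-injective =
    trans (∏-cong (λ x → f-cong (sym (enum∘index (τ x)))))
          (sum-reindex *-commutativeMonoid φ-injective (f ∘ enum))
    where
    φ-injective : Injective _≡_ _≡_ (index ∘ τ ∘ enum)
    φ-injective eq = enum-injective _ _ (τ-injective (index-injective eq))

  decSetoid : DecSetoid c ℓ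
  decSetoid = record { isDecEquivalence = record { isEquivalence = isEquivalence ; _≟_ = _≟_ } }

  open import Data.List.Membership.DecSetoid decSetoid public using (_∈_; _∉_; _∈?_)
  open import Data.List.Relation.Unary.Unique.Setoid setoid public using (Unique)

  ∈-resp-≈ : ∀ {x y D} → x ≈ y → x ∈ D → y ∈ D
  ∈-resp-≈ x≈y = Any.map (trans (sym x≈y))

  ∏ˡ : List Carrier → Carrier
  ∏ˡ = List.foldr _*_ 1#

  ∏ˡ-cong : ∀ {xs ys} → Pointwise _≈_ xs ys → ∏ˡ xs ≈ ∏ˡ ys
  ∏ˡ-cong []             = refl
  ∏ˡ-cong (x≈y ∷ xs≈ys) = *-cong x≈y (∏ˡ-cong xs≈ys)

  except : List Carrier → (Carrier → Carrier) → Carrier → Carrier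
  except D f x with x ∈? D
  ... | yes _ = 1#
  ... | no  _ = f x

  except-∈ : ∀ {D f x} → x ∈ D → except D f x ≈ 1#
  except-∈ {D} {f} {x} x∈D with x ∈? D
  ... | yes _   = refl
  ... | no  x∉D = contradiction x∈D x∉D

  except-∉ : ∀ {D f x} → x ∉ D → except D f x ≈ f x
  except-∉ {D} {f} {x} x∉D with x ∈? D
  ... | yes x∈D = contradiction x∈D x∉D
  ... | no  _   = refl

  except-cong : ∀ {D f} → Congruent _≈_ _≈_ f → Congruent _≈_ _≈_ (except D f)
  except-cong {D} {f} f-cong {x} {y} x≈y with x ∈? D
  ... | yes x∈D = sym (except-∈ (∈-resp-≈ x≈y x∈D))
  ... | no  x∉D = trans (f-cong x≈y) (sym (except-∉ (x∉D ∘ ∈-resp-≈ (sym x≈y))))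

  except-∷ : ∀ {D f x y} → y ≉ x → except D f y ≈ except (x ∷ D) f y
  except-∷ {D} {f} {x} {y} y≉x = by-cases (y ∈? D)
    where
    by-cases : Dec (y ∈ D) → except D f y ≈ except (x ∷ D) f y
    by-cases (yes y∈D) = trans (except-∈ {D} {f} y∈D) (sym (except-∈ {x ∷ D} {f} (there y∈D)))
    by-cases (no  y∉D) = trans (except-∉ {D} {f} y∉D) (sym (except-∉ {x ∷ D} {f} λ { (here y≈x) → y≉x y≈x ; (there y∈D) → y∉D y∈D }))

  ∏∖ : List Carrier → (Carrier → Carrier) → Carrier
  ∏∖ D f = ∏ (except D f)

  ∏∖[] : ∀ f → ∏∖ [] f ≈ ∏ f
  ∏∖[] f = ∏-cong (λ x → except-∉ {[]} {f} {x} λ ())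

  ∏∖-cong : ∀ D {f g} → (∀ x → x ∉ D → f x ≈ g x) → ∏∖ D f ≈ ∏∖ D g
  ∏∖-cong D {f} {g} f≈g = ∏-cong pointwise
    where
    pointwise : ∀ x → except D f x ≈ except D g x
    pointwise x with x ∈? D
    ... | yes _   = refl
    ... | no  x∉D = f≈g x x∉D

  ∏∖-* : ∀ D f g → ∏∖ D (λ x → f x * g x) ≈ ∏∖ D f * ∏∖ D g
  ∏∖-* D f g = trans (∏-cong pointwise) (∏-* (except D f) (except D g))
    where
    pointwise : ∀ x → except D (λ x → f x * g x) x ≈ except D f x * except D g x
    pointwise x with x ∈? D
    ... | yes _ = sym (*-identityˡ 1#)
    ... | no  _ = refl

  ∏∖-∷ : ∀ {D f x} → Congruent _≈_ _≈_ f → x ∉ D → ∏∖ D f ≈ f x * ∏∖ (x ∷ D) f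
  ∏∖-∷ {D} {f} {x} f-cong x∉D = begin
    ∏∖ D f                                  ≈⟨ Fin∏.sum-remove {i = i} (except D f ∘ enum) ⟩
    except D f (enum i) * rest (except D f)  ≈⟨ *-cong fx≈ (Fin∏.sum-cong-≋ λ j → except-∷ {D} {f} (enum-punchIn≉ x j)) ⟩
    f x * rest (except (x ∷ D) f)           ≈⟨ *-congˡ (trans (*-congʳ x∈x∷D) (*-identityˡ _)) ⟨
    f x * (except (x ∷ D) f (enum i) * rest (except (x ∷ D) f))
                                            ≈⟨ *-congˡ (Fin∏.sum-remove {i = i} (except (x ∷ D) f ∘ enum)) ⟨
    f x * ∏∖ (x ∷ D) f                      ∎
    where
    i : Fin (suc n)
    i = index x
    rest : (Carrier → Carrier) → Carrier
    rest g = Fin∏.sum (λ j → g (enum (punchIn i j)))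
    fx≈ : except D f (enum i) ≈ f x
    fx≈ = trans (except-cong {D} f-cong (enum∘index x)) (except-∉ {D} {f} x∉D)
    x∈x∷D : except (x ∷ D) f (enum i) ≈ 1#
    x∈x∷D = except-∈ {x ∷ D} {f} (here (enum∘index x))

  ∏-split : ∀ {f} → Congruent _≈_ _≈_ f → ∀ {D} → Unique D → ∏ f ≈ ∏ˡ (List.map f D) * ∏∖ D f
  ∏-split {f} f-cong {[]}    []             = trans (sym (∏∖[] f)) (sym (*-identityˡ _))
  ∏-split {f} f-cong {x ∷ D} (x≉D ∷ unique) = begin
    ∏ f                                      ≈⟨ ∏-split f-cong unique ⟩
    ∏ˡ (List.map f D) * ∏∖ D f               ≈⟨ *-congˡ (∏∖-∷ f-cong (All¬⇒¬Any x≉D)) ⟩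
    ∏ˡ (List.map f D) * (f x * ∏∖ (x ∷ D) f)  ≈⟨ solve 3 (λ P y R → P :* (y :* R) := (y :* P) :* R) refl _ _ _ ⟩
    (f x * ∏ˡ (List.map f D)) * ∏∖ (x ∷ D) f  ∎

  nz : Carrier → Carrier
  nz = except (0# ∷ []) id

  nz-cong : Congruent _≈_ _≈_ nz
  nz-cong = except-cong {0# ∷ []} id

  nz-zero : ∀ {x} → x ≈ 0# → nz x ≈ 1#
  nz-zero x≈0 = except-∈ (here x≈0)

  nz-unit : ∀ {x} → x ≉ 0# → nz x ≈ x
  nz-unit {x} x≉0 = except-∉ {0# ∷ []} {id} {x} λ { (here x≈0) → x≉0 x≈0 }

  nz≉0 : ∀ x → nz x ≉ 0#
  nz≉0 x = by-cases (x ≟ 0#)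
    where
    by-cases : Dec (x ≈ 0#) → nz x ≉ 0#
    by-cases (yes x≈0) = 1≉0 ∘ trans (sym (nz-zero x≈0))
    by-cases (no  x≉0) = x≉0 ∘ trans (sym (nz-unit x≉0))

  W : Carrier
  W = ∏ nz

  W≉0 : W ≉ 0#
  W≉0 = ∏-nonzero nz≉0

  complement-product : ∀ {τ} → Congruent _≈_ _≈_ τ → Injective _≈_ _≈_ τ →
                       ∀ {D us} → Unique D → Any (λ x → τ x ≈ 0#) D → Pointwise (λ x u → nz (τ x) ≈ u) D us →
                       W ≈ ∏ˡ us * ∏∖ D τ
  complement-product {τ} τ-cong τ-injective {D} {us} unique vanishes values = begin
    W                                         ≈⟨ ∏-reindex {nz} nz-cong τ-injective ⟨
    ∏ (nz ∘ τ)                                ≈⟨ ∏-split {nz ∘ τ} (nz-cong ∘ τ-cong) unique ⟩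
    ∏ˡ (List.map (nz ∘ τ) D) * ∏∖ D (nz ∘ τ)  ≈⟨ *-cong (∏ˡ-cong (map-values values)) (∏∖-cong D λ y y∉D → nz-unit (τ≉0 y∉D)) ⟩
    ∏ˡ us * ∏∖ D τ                           ∎
    where
    τ≉0 : ∀ {y} → y ∉ D → τ y ≉ 0#
    τ≉0 y∉D τy≈0 = y∉D (Any.map (λ τx≈0 → τ-injective (trans τy≈0 (sym τx≈0))) vanishes)
    map-values : ∀ {D us} → Pointwise (λ x u → nz (τ x) ≈ u) D us → Pointwise _≈_ (List.map (nz ∘ τ) D) us
    map-values []               = []
    map-values (value ∷ values) = value ∷ map-values values

  nz-sub : ∀ {x u c} → x ≈ u → u ≉ c → nz (x - c) ≈ u - c
  nz-sub x≈u u≉c = trans (nz-cong (+-congʳ x≈u)) (nz-unit (x≉y⇒x-y≉0 u≉c))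

  nz-sub-zero : ∀ {x c} → x ≈ c → nz (x - c) ≈ 1#
  nz-sub-zero x≈c = nz-zero (x≈y⇒x-y≈0 x≈c)

  shifted-complement-product : ∀ {f} → Congruent _≈_ _≈_ f → Injective _≈_ _≈_ f →
                               ∀ c {D us} → Unique D → Any (λ x → f x ≈ c) D →
                               Pointwise (λ x u → nz (f x - c) ≈ u) D us →
                               W ≈ ∏ˡ us * ∏∖ D (λ x → f x - c)
  shifted-complement-product f-cong f-injective c unique hit =
    complement-product (+-congʳ ∘ f-cong) (f-injective ∘ minus-injective c) unique (Any.map x≈y⇒x-y≈0 hit)

  pow-q : ∀ x → pow x (suc n) ≈ x
  pow-q x with x ≟ 0#
  ... | yes x≈0 = trans (*-cong x≈0 refl) (trans (zeroˡ _) (sym x≈0))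
  ... | no  x≉0 = begin
    pow x (suc n)               ≈⟨ ∏-const x ⟨
    ∏ (λ _ → x)                 ≈⟨ ∏-split (λ _ → refl) ([] ∷ []) ⟩
    (x * 1#) * ∏∖ [0] (λ _ → x)  ≈⟨ *-congˡ ∏∖[0]x≈1 ⟩
    (x * 1#) * 1#               ≈⟨ solve 1 (λ x → (x :* ı) :* ı := x) refl x ⟩
    x                           ∎
    where
    [0] : List Carrier
    [0] = 0# ∷ []
    ∏∖[0]x≈1 : ∏∖ [0] (λ _ → x) ≈ 1#
    ∏∖[0]x≈1 = *-cancelʳ W≉0 (begin
      ∏∖ [0] (λ _ → x) * W          ≈⟨ ∏∖-* [0] (λ _ → x) id ⟨
      ∏∖ [0] (x *_)                 ≈⟨ *-identityˡ _ ⟨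
      1# * ∏∖ [0] (x *_)            ≈⟨ *-congʳ (*-identityʳ 1#) ⟨
      (1# * 1#) * ∏∖ [0] (x *_)     ≈⟨ complement-product *-congˡ (*-cancelˡ x≉0) ([] ∷ []) (here (zeroʳ x)) (nz-zero (zeroʳ x) ∷ []) ⟨
      W                             ≈⟨ *-identityˡ W ⟨
      1# * W                        ∎)

  fermat : ∀ {x} → x ≉ 0# → pow x n ≈ 1#
  fermat {x} x≉0 = *-cancelˡ x≉0 (trans (pow-q x) (sym (*-identityʳ x)))

  pow-1+bn : ∀ x b → pow x (suc (b ℕ.* n)) ≈ x
  pow-1+bn x zero    = *-identityʳ x
  pow-1+bn x (suc b) = begin
    x * pow x (n ℕ.+ b ℕ.* n)        ≈⟨ *-congˡ (pow-+ x n (b ℕ.* n)) ⟩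
    x * (pow x n * pow x (b ℕ.* n))  ≈⟨ *-assoc x _ _ ⟨
    pow x (suc n) * pow x (b ℕ.* n)  ≈⟨ *-congʳ (pow-q x) ⟩
    pow x (suc (b ℕ.* n))            ≈⟨ pow-1+bn x b ⟩
    x                                ∎

  pow-injective : ∀ k → Bézout.Identity 1 (suc k) n → Injective _≈_ _≈_ (λ x → pow x (suc k))
  pow-injective k (Bézout.+- a b 1+bn≡ak) {x} {y} xᵏ≈yᵏ = begin
    x                      ≈⟨ root x ⟨
    pow (pow x (suc k)) a  ≈⟨ pow-cong a xᵏ≈yᵏ ⟩
    pow (pow y (suc k)) a  ≈⟨ root y ⟩
    y                      ∎
    where
    root : ∀ z → pow (pow z (suc k)) a ≈ z
    root z = begin
      pow (pow z (suc k)) a  ≈⟨ pow-* z a (suc k) ⟨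
      pow z (a ℕ.* suc k)    ≡⟨ ≡.cong (pow z) 1+bn≡ak ⟨
      pow z (suc (b ℕ.* n))  ≈⟨ pow-1+bn z b ⟩
      z                      ∎
  pow-injective k (Bézout.-+ a b 1+ak≡bn) {x} {y} xᵏ≈yᵏ with x ≟ 0# | y ≟ 0#
  ... | yes x≈0 | yes y≈0 = trans x≈0 (sym y≈0)
  ... | yes x≈0 | no  y≉0 = contradiction (trans (sym xᵏ≈yᵏ) (pow-zero k x≈0)) (pow-nonzero (suc k) y≉0)
  ... | no  x≉0 | yes y≈0 = contradiction (trans xᵏ≈yᵏ (pow-zero k y≈0)) (pow-nonzero (suc k) x≉0)
  ... | no  x≉0 | no  y≉0 = *-cancelʳ (pow-nonzero a (pow-nonzero (suc k) y≉0)) (begin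
    x * pow (pow y (suc k)) a  ≈⟨ *-congˡ (pow-cong a xᵏ≈yᵏ) ⟨
    x * pow (pow x (suc k)) a  ≈⟨ inverse-power x≉0 ⟩
    1#                         ≈⟨ inverse-power y≉0 ⟨
    y * pow (pow y (suc k)) a  ∎)
    where
    inverse-power : ∀ {z} → z ≉ 0# → z * pow (pow z (suc k)) a ≈ 1#
    inverse-power {z} z≉0 = begin
      z * pow (pow z (suc k)) a  ≈⟨ *-congˡ (pow-* z a (suc k)) ⟨
      pow z (suc (a ℕ.* suc k))  ≡⟨ ≡.cong (pow z) 1+ak≡bn ⟩
      pow z (b ℕ.* n)            ≈⟨ pow-* z b n ⟩
      pow (pow z n) b            ≈⟨ pow-cong b (fermat z≉0) ⟩
      pow 1# b                   ≈⟨ pow-1# b ⟩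
      1#                         ∎

  module Fin∑ = Algebra.Properties.CommutativeMonoid.Sum +-commutativeMonoid
  open import Algebra.Properties.Semiring.Mult semiring using (×1-homo-*) renaming (_×_ to _·_)

  q·1≈0 : suc n · 1# ≈ 0#
  q·1≈0 = identityʳ-unique Σ _ (begin
    Σ + suc n · 1#                   ≈⟨ +-congˡ (Fin∑.sum-replicate (suc n) {1#}) ⟨
    Σ + Fin∑.sum {suc n} (λ _ → 1#)  ≈⟨ Fin∑.∑-distrib-+ enum (λ _ → 1#) ⟨
    Fin∑.sum (λ i → enum i + 1#)     ≈⟨ Fin∑.sum-cong-≋ (λ i → sym (enum∘index (enum i + 1#))) ⟩
    Fin∑.sum (enum ∘ φ)              ≈⟨ sum-reindex +-commutativeMonoid φ-injective enum ⟩
    Σ                                ∎)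
    where
    Σ : Carrier
    Σ = Fin∑.sum enum
    φ : Fin (suc n) → Fin (suc n)
    φ i = index (enum i + 1#)
    φ-injective : Injective _≡_ _≡_ φ
    φ-injective eq = enum-injective _ _ (+-cancelʳ 1# _ _ (index-injective eq))

  two≉0 : ∀ t → n ≡ t ℕ.* 2 → two ≉ 0#
  two≉0 t n≡t*2 two≈0 = 1≉0 (begin
    1#                        ≈⟨ +-identityʳ 1# ⟨
    1# + 0#                   ≈⟨ +-congˡ (zeroʳ (t · 1#)) ⟨
    1# + t · 1# * 0#          ≈⟨ +-congˡ (*-congˡ (trans (+-congˡ (+-identityʳ 1#)) two≈0)) ⟨
    1# + t · 1# * 2 · 1#      ≈⟨ +-congˡ (×1-homo-* t 2) ⟨
    1# + (t ℕ.* 2) · 1#       ≡⟨ ≡.cong (λ m → 1# + m · 1#) n≡t*2 ⟨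
    suc n · 1#                ≈⟨ q·1≈0 ⟩
    0#                        ∎)

  data Degree< : ℕ → (Carrier → Carrier) → Set (c ⊔ ℓ) where
    vanishing : ∀ {f} → (∀ x → f x ≈ 0#) → Degree< 0 f
    horner    : ∀ {d f} a g → Degree< d g → (∀ x → f x ≈ a + x * g x) → Degree< (suc d) f

  data Monic : ℕ → (Carrier → Carrier) → Set (c ⊔ ℓ) where
    one    : ∀ {f} → (∀ x → f x ≈ 1#) → Monic 0 f
    horner : ∀ {d f} a g → Monic d g → (∀ x → f x ≈ a + x * g x) → Monic (suc d) f

  Degree<-scale : ∀ {d g} r → Degree< d g → Degree< d (λ x → r * g x)
  Degree<-scale r (vanishing g≈0) = vanishing (λ x → trans (*-congˡ (g≈0 x)) (zeroʳ r))
  Degree<-scale r (horner a g deg f≈) = horner (r * a) (λ x → r * g x) (Degree<-scale r deg)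
    (λ x → trans (*-congˡ (f≈ x)) (solve 4 (λ r a x g → r :* (a :+ x :* g) := r :* a :+ x :* (r :* g)) refl r a x (g x)))

  Monic⇒Degree< : ∀ {d f} → Monic d f → Degree< (suc d) f
  Monic⇒Degree< (one f≈1) = horner 1# (λ _ → 0#) (vanishing (λ _ → refl))
    (λ x → trans (f≈1 x) (solve 1 (λ x → ı := ı :+ x :* con (0 , 0)) refl x))
  Monic⇒Degree< (horner a g monic f≈) = horner a g (Monic⇒Degree< monic) f≈

  Monic-+ : ∀ {d f g} → Monic d f → Degree< d g → Monic d (λ x → f x + g x)
  Monic-+ (one f≈1) (vanishing g≈0) = one (λ x → trans (+-cong (f≈1 x) (g≈0 x)) (+-identityʳ 1#))
  Monic-+ (horner a f′ monic f≈) (horner b g′ deg g≈) = horner (a + b) (λ x → f′ x + g′ x) (Monic-+ monic deg)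
    (λ x → trans (+-cong (f≈ x) (g≈ x))
      (solve 5 (λ a b x f g → (a :+ x :* f) :+ (b :+ x :* g) := (a :+ b) :+ x :* (f :+ g)) refl a b x (f′ x) (g′ x)))

  Monic-divide : ∀ {d f} → Monic (suc d) f → ∀ r →
                 ∃ λ g → Monic d g × (∀ x → f x - f r ≈ (x - r) * g x)
  Monic-divide {zero} {f} (horner a g (one g≈1) f≈) r = (λ _ → 1#) , one (λ _ → refl) , λ x → begin
    f x - f r                      ≈⟨ +-cong (f≈ x) (-‿cong (f≈ r)) ⟩
    (a + x * g x) - (a + r * g r)  ≈⟨ +-cong (+-congˡ (*-congˡ (g≈1 x))) (-‿cong (+-congˡ (*-congˡ (g≈1 r)))) ⟩
    (a + x * 1#) - (a + r * 1#)    ≈⟨ solve 3 (λ a x r → (a :+ x :* ı) :- (a :+ r :* ı) := (x :- r) :* ı) refl a x r ⟩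
    (x - r) * 1#                   ∎
  Monic-divide {suc d} {f} (horner a g monic f≈) r with Monic-divide monic r
  ... | g′ , monic′ , g≈ = (λ x → g x + r * g′ x) , Monic-+ monic (Degree<-scale r (Monic⇒Degree< monic′)) , λ x → begin
    f x - f r                            ≈⟨ +-cong (f≈ x) (-‿cong (f≈ r)) ⟩
    (a + x * g x) - (a + r * g r)        ≈⟨ solve 5 (λ a x r gx gr → (a :+ x :* gx) :- (a :+ r :* gr) := (x :- r) :* gx :+ r :* (gx :- gr)) refl a x r (g x) (g r) ⟩
    (x - r) * g x + r * (g x - g r)      ≈⟨ +-congˡ (*-congˡ (g≈ x)) ⟩
    (x - r) * g x + r * ((x - r) * g′ x)  ≈⟨ solve 4 (λ x r gx g′x → (x :- r) :* gx :+ r :* ((x :- r) :* g′x) := (x :- r) :* (gx :+ r :* g′x)) refl x r (g x) (g′ x) ⟩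
    (x - r) * (g x + r * g′ x)           ∎

  Monic-roots≤degree : ∀ {m d f} → Monic d f → (r : Fin m → Carrier) → (∀ {i j} → r i ≈ r j → i ≡ j) →
                       (∀ i → f (r i) ≈ 0#) → m ℕ.≤ d
  Monic-roots≤degree {zero}              _          _ _          _     = ℕ.z≤n
  Monic-roots≤degree {suc m} {zero}      (one f≈1)  r _          roots = contradiction (trans (sym (f≈1 _)) (roots Fin.zero)) 1≉0
  Monic-roots≤degree {suc m} {suc d} {f} monic      r r-injective roots with Monic-divide monic (r Fin.zero)
  ... | g , monic′ , f≈ = ℕ.s≤s (Monic-roots≤degree monic′ (r ∘ Fin.suc) (Fin.suc-injective ∘ r-injective) g-roots)
    where
    g-roots : ∀ i → g (r (Fin.suc i)) ≈ 0#
    g-roots i = *-cancelˡ (x≉y⇒x-y≉0 (λ e → Fin.0≢1+n (≡.sym (r-injective e)))) (begin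
      (r (Fin.suc i) - r Fin.zero) * g (r (Fin.suc i))  ≈⟨ f≈ (r (Fin.suc i)) ⟨
      f (r (Fin.suc i)) - f (r Fin.zero)                ≈⟨ x≈y⇒x-y≈0 (trans (roots (Fin.suc i)) (sym (roots Fin.zero))) ⟩
      0#                                                ≈⟨ zeroʳ _ ⟨
      (r (Fin.suc i) - r Fin.zero) * 0#                 ∎)

  pow-Monic : ∀ j → Monic j (λ x → pow x j)
  pow-Monic zero    = one (λ _ → refl)
  pow-Monic (suc j) = horner 0# (λ x → pow x j) (pow-Monic j) (λ x → sym (+-identityˡ _))

  nonzero-roots≤degree : ∀ j → (∀ x → x ≉ 0# → pow x (suc j) ≈ 1#) → n ℕ.≤ suc j
  nonzero-roots≤degree j all-roots = Monic-roots≤degree monic r r-injective (λ i → x≈y⇒x-y≈0 (all-roots (r i) (enum-punchIn≉ 0# i)))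
    where
    monic : Monic (suc j) (λ x → pow x (suc j) - 1#)
    monic = horner (- 1#) (λ x → pow x j) (pow-Monic j) (λ x → +-comm _ _)
    r : Fin n → Carrier
    r i = enum (punchIn (index 0#) i)
    r-injective : ∀ {i j} → r i ≈ r j → i ≡ j
    r-injective e = Fin.punchIn-injective (index 0#) _ _ (enum-injective _ _ e)

module Collisions {c ℓ : Level} {n : ℕ} (F : FiniteField c ℓ (suc n)) where
  open FiniteField F
  open FiniteFieldProperties F
  open import Relation.Binary.Reasoning.Setoid setoid
  open import Relation.Nullary.Decidable using (_×-dec_)

  h-cong : ∀ k {x y} → x ≈ y → h k x ≈ h k y
  h-cong zero    x≈y = refl
  h-cong (suc k) x≈y = +-cong (h-cong k x≈y) (pow-cong (suc k) x≈y)

  h-0 : ∀ k → h k 0# ≈ 1#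
  h-0 zero    = refl
  h-0 (suc k) = trans (+-cong (h-0 k) (zeroˡ _)) (+-identityʳ 1#)

  h-geometric : ∀ k y → h k y * (y - 1#) ≈ y * pow y k - 1#
  h-geometric zero    y = solve 1 (λ y → ı :* (y :- ı) := y :* ı :- ı) refl y
  h-geometric (suc k) y = begin
    (h k y + y * pow y k) * (y - 1#)             ≈⟨ solve 3 (λ H y p → (H :+ y :* p) :* (y :- ı) := H :* (y :- ı) :+ y :* p :* (y :- ı)) refl (h k y) y (pow y k) ⟩
    h k y * (y - 1#) + y * pow y k * (y - 1#)    ≈⟨ +-congʳ (h-geometric k y) ⟩
    (y * pow y k - 1#) + y * pow y k * (y - 1#)  ≈⟨ solve 2 (λ y p → (y :* p :- ı) :+ y :* p :* (y :- ı) := y :* (y :* p) :- ı) refl y (pow y k) ⟩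
    y * (y * pow y k) - 1#                       ∎

  [h-1][y-1] : ∀ k y → (h k y - 1#) * (y - 1#) ≈ (pow y k - 1#) * y
  [h-1][y-1] k y = begin
    (h k y - 1#) * (y - 1#)        ≈⟨ solve 2 (λ H y → (H :- ı) :* (y :- ı) := H :* (y :- ı) :- (y :- ı)) refl (h k y) y ⟩
    h k y * (y - 1#) - (y - 1#)    ≈⟨ +-congʳ (h-geometric k y) ⟩
    (y * pow y k - 1#) - (y - 1#)  ≈⟨ solve 2 (λ y p → (y :* p :- ı) :- (y :- ı) := (p :- ı) :* y) refl y (pow y k) ⟩
    (pow y k - 1#) * y             ∎

  [H-1][K-s][G-m]≈[H-m][K-1][G-s] :
    ∀ {H K G m s a y} → y ≉ 1# → y ≉ a →
    H * (y - 1#) ≈ y * K - 1# → G * (y - a) ≈ y * K - a * s → m * (a - 1#) ≈ a * s - 1# →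
    (H - 1#) * (K - s) * (G - m) ≈ (H - m) * (K - 1#) * (G - s)
  [H-1][K-s][G-m]≈[H-m][K-1][G-s] {H} {K} {G} {m} {s} {a} {y} y≉1 y≉a H-eq G-eq m-eq =
    *-cancelʳ (*-nonzero (x≉y⇒x-y≉0 y≉1) (x≉y⇒x-y≉0 y≉a)) (begin
      (H - 1#) * (K - s) * (G - m) * ((y - 1#) * (y - a))      ≈⟨ solve 7 (λ H K G m s a y → (H :- ı) :* (K :- s) :* (G :- m) :* ((y :- ı) :* (y :- a)) := ((H :- ı) :* (y :- ı)) :* (K :- s) :* ((G :- m) :* (y :- a))) refl H K G m s a y ⟩
      ((H - 1#) * (y - 1#)) * (K - s) * ((G - m) * (y - a))    ≈⟨ *-cong (*-congʳ H-1) G-m ⟩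
      (y * (K - 1#)) * (K - s) * ((H - m) * (y - 1#))          ≈⟨ solve 6 (λ H K m s a y → (y :* (K :- ı)) :* (K :- s) :* ((H :- m) :* (y :- ı)) := (H :- m) :* (K :- ı) :* (y :* (K :- s)) :* (y :- ı)) refl H K m s a y ⟩
      (H - m) * (K - 1#) * (y * (K - s)) * (y - 1#)            ≈⟨ *-congʳ (*-congˡ G-s) ⟨
      (H - m) * (K - 1#) * ((G - s) * (y - a)) * (y - 1#)      ≈⟨ solve 7 (λ H K G m s a y → (H :- m) :* (K :- ı) :* ((G :- s) :* (y :- a)) :* (y :- ı) := (H :- m) :* (K :- ı) :* (G :- s) :* ((y :- ı) :* (y :- a))) refl H K G m s a y ⟩
      (H - m) * (K - 1#) * (G - s) * ((y - 1#) * (y - a))      ∎)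
    where
    H-1 : (H - 1#) * (y - 1#) ≈ y * (K - 1#)
    H-1 = x-y≈0⇒x≈y (begin
      (H - 1#) * (y - 1#) - y * (K - 1#)  ≈⟨ solve 3 (λ H K y → (H :- ı) :* (y :- ı) :- y :* (K :- ı) := H :* (y :- ı) :- (y :* K :- ı)) refl H K y ⟩
      H * (y - 1#) - (y * K - 1#)         ≈⟨ x≈y⇒x-y≈0 H-eq ⟩
      0#                                  ∎)
    G-s : (G - s) * (y - a) ≈ y * (K - s)
    G-s = x-y≈0⇒x≈y (begin
      (G - s) * (y - a) - y * (K - s)  ≈⟨ solve 5 (λ G K s a y → (G :- s) :* (y :- a) :- y :* (K :- s) := G :* (y :- a) :- (y :* K :- a :* s)) refl G K s a y ⟩
      G * (y - a) - (y * K - a * s)    ≈⟨ x≈y⇒x-y≈0 G-eq ⟩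
      0#                               ∎)
    G-m : (G - m) * (y - a) ≈ (H - m) * (y - 1#)
    G-m = x-y≈0⇒x≈y (begin
      (G - m) * (y - a) - (H - m) * (y - 1#)  ≈⟨ solve 7 (λ H K G m s a y → (G :- m) :* (y :- a) :- (H :- m) :* (y :- ı) := (G :* (y :- a) :- (y :* K :- a :* s)) :- (H :* (y :- ı) :- (y :* K :- ı)) :+ (m :* (a :- ı) :- (a :* s :- ı))) refl H K G m s a y ⟩
      (G * (y - a) - (y * K - a * s)) - (H * (y - 1#) - (y * K - 1#)) + (m * (a - 1#) - (a * s - 1#))
                                              ≈⟨ +-cong (+-cong (x≈y⇒x-y≈0 G-eq) (-‿cong (x≈y⇒x-y≈0 H-eq))) (x≈y⇒x-y≈0 m-eq) ⟩
      (0# - 0#) + 0#                          ≈⟨ solve 0 ((con (0 , 0) :- con (0 , 0)) :+ con (0 , 0) := con (0 , 0)) refl ⟩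
      0#                                      ∎)

  Collision : ℕ → Carrier → Carrier → Set ℓ
  Collision k c₁ c₂ = c₁ ≉ 0# × c₁ ≉ 1# × c₂ ≉ 0# × c₂ ≉ 1# × c₁ ≉ c₂ × h k c₁ ≈ h k c₂

  Collision-resp : ∀ k {c₁ c₁′ c₂ c₂′} → c₁ ≈ c₁′ → c₂ ≈ c₂′ → Collision k c₁ c₂ → Collision k c₁′ c₂′
  Collision-resp k c₁≈ c₂≈ (c₁≉0 , c₁≉1 , c₂≉0 , c₂≉1 , c₁≉c₂ , h≈h) =
    c₁≉0 ∘ trans c₁≈ , c₁≉1 ∘ trans c₁≈ , c₂≉0 ∘ trans c₂≈ , c₂≉1 ∘ trans c₂≈ ,
    (λ e → c₁≉c₂ (trans c₁≈ (trans e (sym c₂≈)))) , trans (sym (h-cong k c₁≈)) (trans h≈h (h-cong k c₂≈))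

  collision? : ∀ k → Dec (∃₂ (Collision k))
  collision? k = ∃₂? (Collision-resp k) λ c₁ c₂ →
    ¬? (c₁ ≟ 0#) ×-dec ¬? (c₁ ≟ 1#) ×-dec ¬? (c₂ ≟ 0#) ×-dec ¬? (c₂ ≟ 1#) ×-dec ¬? (c₁ ≟ c₂) ×-dec (h k c₁ ≟ h k c₂)

  module NoCollision (k : ℕ) (pow-k-injective : Injective _≈_ _≈_ (λ x → pow x k)) (two≉0 : two ≉ 0#)
                     (no-collision : ∀ c₁ c₂ → ¬ Collision k c₁ c₂) where

    pk : Carrier → Carrier
    pk x = pow x k

    pk-0 : pk 0# ≈ 0#
    pk-0 = injective-pow-0# k pow-k-injective

    pk-1 : pk 1# ≈ 1#
    pk-1 = pow-1# k

    pk≉1 : ∀ {x} → x ≉ 1# → pk x ≉ 1#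
    pk≉1 x≉1 pkx≈1 = x≉1 (pow-k-injective (trans pkx≈1 (sym pk-1)))

    h≉1 : ∀ {x} → x ≉ 0# → x ≉ 1# → h k x ≉ 1#
    h≉1 {x} x≉0 x≉1 hx≈1 = *-nonzero (x≉y⇒x-y≉0 (pk≉1 x≉1)) x≉0 (begin
      (pk x - 1#) * x          ≈⟨ [h-1][y-1] k x ⟨
      (h k x - 1#) * (x - 1#)  ≈⟨ *-congʳ (x≈y⇒x-y≈0 hx≈1) ⟩
      0# * (x - 1#)            ≈⟨ zeroˡ _ ⟩
      0#                       ∎)

    h-injective : ∀ {x y} → x ≉ 1# → y ≉ 1# → h k x ≈ h k y → x ≈ y
    h-injective {x} {y} x≉1 y≉1 hx≈hy with x ≟ 0# | y ≟ 0#
    ... | yes x≈0 | yes y≈0 = trans x≈0 (sym y≈0)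
    ... | yes x≈0 | no  y≉0 = contradiction (trans (sym hx≈hy) (trans (h-cong k x≈0) (h-0 k))) (h≉1 y≉0 y≉1)
    ... | no  x≉0 | yes y≈0 = contradiction (trans hx≈hy (trans (h-cong k y≈0) (h-0 k))) (h≉1 x≉0 x≉1)
    ... | no  x≉0 | no  y≉0 =
      decidable-stable (x ≟ y) (λ x≉y → no-collision x y (x≉0 , x≉1 , y≉0 , y≉1 , x≉y , hx≈hy))

    open ExtendInjective 1# (h-cong k) h-injective using (σ; σ-cong; σ-injective) renaming (σ≈f to σ≈h)

    σ0≈1 : σ 0# ≈ 1#
    σ0≈1 = trans (σ≈h 0≉1) (h-0 k)

    σ1≉1 : σ 1# ≉ 1#
    σ1≉1 σ1≈1 = 0≉1 (σ-injective (trans σ0≈1 (sym σ1≈1)))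

    h≉σ1 : ∀ {y} → y ≉ 1# → h k y ≉ σ 1#
    h≉σ1 y≉1 hy≈σ1 = y≉1 (σ-injective (trans (σ≈h y≉1) hy≈σ1))

    σ1≈two : σ 1# ≈ two
    σ1≈two = begin
      σ 1#                                    ≈⟨ solve 1 (λ v → v := ⅱ :- ((ı :* ((v :- ı) :* ı)) :* ((con (0 , 0) :- ı) :* (ı :* ı))
                                                                      :- ((con (0 , 0) :- ı) :* (ı :* ı)) :* (ı :* (ı :* ı)))) refl (σ 1#) ⟩
      two - (N-σ-1 * N-id-1 - N-pk-1 * N-id)  ≈⟨ +-congˡ (-‿cong (x≈y⇒x-y≈0 N-identity)) ⟩
      two - 0#                                ≈⟨ solve 0 (ⅱ :- con (0 , 0) := ⅱ) refl ⟩
      two                                     ∎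
      where
      D : List Carrier
      D = 0# ∷ 1# ∷ []
      D-unique : Unique D
      D-unique = (0≉1 ∷ []) ∷ [] ∷ []
      N-σ-1 N-id-1 N-pk-1 N-id : Carrier
      N-σ-1  = ∏ˡ (1# ∷ σ 1# - 1# ∷ [])
      N-id-1 = ∏ˡ (0# - 1# ∷ 1# ∷ [])
      N-pk-1 = ∏ˡ (0# - 1# ∷ 1# ∷ [])
      N-id   = ∏ˡ (1# ∷ 1# ∷ [])
      W≈σ-1 : W ≈ N-σ-1 * ∏∖ D (λ y → σ y - 1#)
      W≈σ-1 = shifted-complement-product σ-cong σ-injective 1# D-unique (here σ0≈1) (nz-sub-zero σ0≈1 ∷ nz-sub refl σ1≉1 ∷ [])
      W≈id-1 : W ≈ N-id-1 * ∏∖ D (λ y → y - 1#)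
      W≈id-1 = shifted-complement-product id id 1# D-unique (there (here refl)) (nz-sub refl 0≉1 ∷ nz-sub-zero refl ∷ [])
      W≈pk-1 : W ≈ N-pk-1 * ∏∖ D (λ y → pk y - 1#)
      W≈pk-1 = shifted-complement-product (pow-cong k) pow-k-injective 1# D-unique (there (here pk-1)) (nz-sub pk-0 0≉1 ∷ nz-sub-zero pk-1 ∷ [])
      W≈id : W ≈ N-id * ∏∖ D id
      W≈id = complement-product id id D-unique (here refl) (nz-zero refl ∷ nz-unit 1≉0 ∷ [])
      X-identity : ∏∖ D (λ y → σ y - 1#) * ∏∖ D (λ y → y - 1#) ≈ ∏∖ D (λ y → pk y - 1#) * ∏∖ D id
      X-identity = begin
        ∏∖ D (λ y → σ y - 1#) * ∏∖ D (λ y → y - 1#)    ≈⟨ ∏∖-* D (λ y → σ y - 1#) (λ y → y - 1#) ⟨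
        ∏∖ D (λ y → (σ y - 1#) * (y - 1#))            ≈⟨ ∏∖-cong D (λ y y∉D → trans (*-congʳ (+-congʳ (σ≈h (y∉D ∘ there ∘ here)))) ([h-1][y-1] k y)) ⟩
        ∏∖ D (λ y → (pk y - 1#) * y)                  ≈⟨ ∏∖-* D (λ y → pk y - 1#) id ⟩
        ∏∖ D (λ y → pk y - 1#) * ∏∖ D id              ∎
      N-identity : N-σ-1 * N-id-1 ≈ N-pk-1 * N-id
      N-identity = balance (*-nonzero W≉0 W≉0) (factor-* W≈σ-1 W≈id-1) (factor-* W≈pk-1 W≈id) X-identity

    module AtPoint {a : Carrier} (a≉0 : a ≉ 0#) (a≉1 : a ≉ 1#) where

      s m : Carrier
      s = pk a
      m = h k a

      a⁻¹ : Carrier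
      a⁻¹ = proj₁ (inverse a a≉0)

      aa⁻¹≈1 : a * a⁻¹ ≈ 1#
      aa⁻¹≈1 = proj₂ (inverse a a≉0)

      a⁻¹≉0 : a⁻¹ ≉ 0#
      a⁻¹≉0 a⁻¹≈0 = 1≉0 (trans (sym aa⁻¹≈1) (trans (*-congˡ a⁻¹≈0) (zeroʳ a)))

      m-geometric : m * (a - 1#) ≈ a * s - 1#
      m-geometric = h-geometric k a

      s≉0 : s ≉ 0#
      s≉0 = pow-nonzero k a≉0

      s≉1 : s ≉ 1#
      s≉1 = pk≉1 a≉1

      m≉1 : m ≉ 1#
      m≉1 = h≉1 a≉0 a≉1

      m≉two : m ≉ two
      m≉two m≈two = h≉σ1 a≉1 (trans m≈two (sym σ1≈two))

      s≉m : s ≉ m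
      s≉m s≈m = s≉1 (begin
        s                      ≈⟨ solve 2 (λ s a → s := a :* s :- s :* (a :- ı)) refl s a ⟩
        a * s - s * (a - 1#)   ≈⟨ +-congˡ (-‿cong (trans (*-congʳ s≈m) m-geometric)) ⟩
        a * s - (a * s - 1#)   ≈⟨ solve 2 (λ s a → a :* s :- (a :* s :- ı) := ı) refl s a ⟩
        1#                     ∎)

      G : Carrier → Carrier
      G y = s * σ (y * a⁻¹)

      G-cong : Congruent _≈_ _≈_ G
      G-cong = *-congˡ ∘ σ-cong ∘ *-congʳ

      G-injective : Injective _≈_ _≈_ G
      G-injective = *-cancelʳ a⁻¹≉0 ∘ σ-injective ∘ *-cancelˡ s≉0

      G0≈s : G 0# ≈ s
      G0≈s = trans (*-congˡ (trans (σ-cong (zeroˡ a⁻¹)) σ0≈1)) (*-identityʳ s)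

      Ga≈two*s : G a ≈ two * s
      Ga≈two*s = trans (*-congˡ (trans (σ-cong aa⁻¹≈1) σ1≈two)) (*-comm s two)

      G-geometric : ∀ y → y ≉ a → G y * (y - a) ≈ y * pk y - a * s
      G-geometric y y≉a = begin
        G y * (y - a)                  ≈⟨ *-congʳ (*-congˡ (σ≈h τ≉1)) ⟩
        s * h k τ * (y - a)            ≈⟨ *-congˡ (+-congʳ τa≈y) ⟨
        s * h k τ * (τ * a - a)        ≈⟨ solve 4 (λ S H T A → S :* H :* (T :* A :- A) := (H :* (T :- ı)) :* (S :* A)) refl s (h k τ) τ a ⟩
        h k τ * (τ - 1#) * (s * a)     ≈⟨ *-congʳ (h-geometric k τ) ⟩
        (τ * pk τ - 1#) * (s * a)      ≈⟨ solve 4 (λ T P S A → (T :* P :- ı) :* (S :* A) := (T :* A) :* (P :* S) :- A :* S) refl τ (pk τ) s a ⟩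
        (τ * a) * (pk τ * s) - a * s   ≈⟨ +-congʳ (*-cong τa≈y pkτ*s≈pky) ⟩
        y * pk y - a * s               ∎
        where
        τ : Carrier
        τ = y * a⁻¹
        τa≈y : τ * a ≈ y
        τa≈y = trans (*-assoc y a⁻¹ a) (trans (*-congˡ (trans (*-comm a⁻¹ a) aa⁻¹≈1)) (*-identityʳ y))
        τ≉1 : τ ≉ 1#
        τ≉1 τ≈1 = y≉a (trans (sym τa≈y) (trans (*-congʳ τ≈1) (*-identityˡ a)))
        pkτ*s≈pky : pk τ * s ≈ pk y
        pkτ*s≈pky = trans (sym (pow-distrib-* τ a k)) (pow-cong k τa≈y)

      G1≈m : G 1# ≈ m
      G1≈m = *-cancelʳ (x≉y⇒x-y≉0 (a≉1 ∘ sym)) (begin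
        G 1# * (1# - a)                                    ≈⟨ G-geometric 1# (a≉1 ∘ sym) ⟩
        1# * pk 1# - a * s                                 ≈⟨ +-congʳ (*-congˡ pk-1) ⟩
        1# * 1# - a * s                                    ≈⟨ solve 3 (λ M A S → ı :* ı :- A :* S := M :* (ı :- A) :+ (M :* (A :- ı) :- (A :* S :- ı))) refl m a s ⟩
        m * (1# - a) + (m * (a - 1#) - (a * s - 1#))       ≈⟨ +-congˡ (x≈y⇒x-y≈0 m-geometric) ⟩
        m * (1# - a) + 0#                                  ≈⟨ +-identityʳ _ ⟩
        m * (1# - a)                                       ∎)

      two*s≉m : two * s ≉ m
      two*s≉m two*s≈m = a≉1 (G-injective (trans Ga≈two*s (trans two*s≈m (sym G1≈m))))

      two*s≉s : two * s ≉ s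
      two*s≉s two*s≈s = s≉0 (begin
        s             ≈⟨ solve 1 (λ S → S := ⅱ :* S :- S) refl s ⟩
        two * s - s   ≈⟨ x≈y⇒x-y≈0 two*s≈s ⟩
        0#            ∎)

      D : List Carrier
      D = 0# ∷ 1# ∷ a ∷ []

      D-unique : Unique D
      D-unique = (0≉1 ∷ a≉0 ∘ sym ∷ []) ∷ (a≉1 ∘ sym ∷ []) ∷ [] ∷ []

      X : (Carrier → Carrier) → Carrier → Carrier
      X f c = ∏∖ D (λ y → f y - c)

      N-σ-1 N-σ-m N-pk-1 N-pk-s N-G-s N-G-m : Carrier
      N-σ-1  = ∏ˡ (1# ∷ two - 1# ∷ m - 1# ∷ [])
      N-σ-m  = ∏ˡ (1# - m ∷ two - m ∷ 1# ∷ [])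
      N-pk-1 = ∏ˡ (0# - 1# ∷ 1# ∷ s - 1# ∷ [])
      N-pk-s = ∏ˡ (0# - s ∷ 1# - s ∷ 1# ∷ [])
      N-G-s  = ∏ˡ (1# ∷ m - s ∷ two * s - s ∷ [])
      N-G-m  = ∏ˡ (s - m ∷ 1# ∷ two * s - m ∷ [])

      W≈σ-1 : W ≈ N-σ-1 * X σ 1#
      W≈σ-1 = shifted-complement-product σ-cong σ-injective 1# D-unique (here σ0≈1)
        (nz-sub-zero σ0≈1 ∷ nz-sub σ1≈two two≉1 ∷ nz-sub (σ≈h a≉1) m≉1 ∷ [])

      W≈σ-m : W ≈ N-σ-m * X σ m
      W≈σ-m = shifted-complement-product σ-cong σ-injective m D-unique (there (there (here (σ≈h a≉1))))
        (nz-sub σ0≈1 (m≉1 ∘ sym) ∷ nz-sub σ1≈two (m≉two ∘ sym) ∷ nz-sub-zero (σ≈h a≉1) ∷ [])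

      W≈pk-1 : W ≈ N-pk-1 * X pk 1#
      W≈pk-1 = shifted-complement-product (pow-cong k) pow-k-injective 1# D-unique (there (here pk-1))
        (nz-sub pk-0 0≉1 ∷ nz-sub-zero pk-1 ∷ nz-sub refl s≉1 ∷ [])

      W≈pk-s : W ≈ N-pk-s * X pk s
      W≈pk-s = shifted-complement-product (pow-cong k) pow-k-injective s D-unique (there (there (here refl)))
        (nz-sub pk-0 (s≉0 ∘ sym) ∷ nz-sub pk-1 (s≉1 ∘ sym) ∷ nz-sub-zero refl ∷ [])

      W≈G-s : W ≈ N-G-s * X G s
      W≈G-s = shifted-complement-product G-cong G-injective s D-unique (here G0≈s)
        (nz-sub-zero G0≈s ∷ nz-sub G1≈m (s≉m ∘ sym) ∷ nz-sub Ga≈two*s two*s≉s ∷ [])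

      W≈G-m : W ≈ N-G-m * X G m
      W≈G-m = shifted-complement-product G-cong G-injective m D-unique (there (here G1≈m))
        (nz-sub G0≈s s≉m ∷ nz-sub-zero G1≈m ∷ nz-sub Ga≈two*s two*s≉m ∷ [])

      X-identity : (X σ 1# * X pk s) * X G m ≈ (X σ m * X pk 1#) * X G s
      X-identity = begin
        (X σ 1# * X pk s) * X G m                              ≈⟨ *-congʳ (∏∖-* D (λ y → σ y - 1#) (λ y → pk y - s)) ⟨
        ∏∖ D (λ y → (σ y - 1#) * (pk y - s)) * X G m           ≈⟨ ∏∖-* D (λ y → (σ y - 1#) * (pk y - s)) (λ y → G y - m) ⟨
        ∏∖ D (λ y → (σ y - 1#) * (pk y - s) * (G y - m))       ≈⟨ ∏∖-cong D pointwise ⟩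
        ∏∖ D (λ y → (σ y - m) * (pk y - 1#) * (G y - s))       ≈⟨ ∏∖-* D (λ y → (σ y - m) * (pk y - 1#)) (λ y → G y - s) ⟩
        ∏∖ D (λ y → (σ y - m) * (pk y - 1#)) * X G s           ≈⟨ *-congʳ (∏∖-* D (λ y → σ y - m) (λ y → pk y - 1#)) ⟩
        (X σ m * X pk 1#) * X G s                              ∎
        where
        pointwise : ∀ y → y ∉ D → (σ y - 1#) * (pk y - s) * (G y - m) ≈ (σ y - m) * (pk y - 1#) * (G y - s)
        pointwise y y∉D = begin
          (σ y - 1#) * (pk y - s) * (G y - m)    ≈⟨ *-congʳ (*-congʳ (+-congʳ (σ≈h y≉1))) ⟩
          (h k y - 1#) * (pk y - s) * (G y - m)  ≈⟨ [H-1][K-s][G-m]≈[H-m][K-1][G-s] y≉1 y≉a (h-geometric k y) (G-geometric y y≉a) m-geometric ⟩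
          (h k y - m) * (pk y - 1#) * (G y - s)  ≈⟨ *-congʳ (*-congʳ (+-congʳ (σ≈h y≉1))) ⟨
          (σ y - m) * (pk y - 1#) * (G y - s)    ∎
          where
          y≉1 : y ≉ 1#
          y≉1 = y∉D ∘ there ∘ here
          y≉a : y ≉ a
          y≉a = y∉D ∘ there ∘ there ∘ here

      N-identity : (N-σ-1 * N-pk-s) * N-G-m ≈ (N-σ-m * N-pk-1) * N-G-s
      N-identity = balance (*-nonzero (*-nonzero W≉0 W≉0) W≉0)
        (factor-* (factor-* W≈σ-1 W≈pk-s) W≈G-m) (factor-* (factor-* W≈σ-m W≈pk-1) W≈G-s) X-identity

      Δ : Carrier
      Δ = (m - 1#) * s * (1# - s) * (s - m)

      Δ≉0 : Δ ≉ 0#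
      Δ≉0 = *-nonzero (*-nonzero (*-nonzero (x≉y⇒x-y≉0 m≉1) s≉0) (x≉y⇒x-y≉0 (s≉1 ∘ sym))) (x≉y⇒x-y≉0 s≉m)

      m-two*s≈two-m : m - two * s ≈ two - m
      m-two*s≈two-m = *-cancelˡ Δ≉0 (begin
        Δ * (m - two * s)         ≈⟨ solve 2 (λ M S → (M :- ı) :* S :* (ı :- S) :* (S :- M) :* (M :- ⅱ :* S)
                                        := ((ı :* ((ⅱ :- ı) :* ((M :- ı) :* ı))) :* ((con (0 , 0) :- S) :* ((ı :- S) :* (ı :* ı))))
                                           :* ((S :- M) :* (ı :* ((ⅱ :* S :- M) :* ı)))) refl m s ⟩
        (N-σ-1 * N-pk-s) * N-G-m  ≈⟨ N-identity ⟩
        (N-σ-m * N-pk-1) * N-G-s  ≈⟨ solve 2 (λ M S → (((ı :- M) :* ((ⅱ :- M) :* (ı :* ı))) :* ((con (0 , 0) :- ı) :* (ı :* ((S :- ı) :* ı))))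
                                           :* (ı :* ((M :- S) :* ((ⅱ :* S :- S) :* ı)))
                                        := (M :- ı) :* S :* (ı :- S) :* (S :- M) :* (ⅱ :- M)) refl m s ⟩
        Δ * (two - m)             ∎)

      m≈1+s : m ≈ 1# + s
      m≈1+s = x-y≈0⇒x≈y (*-cancelˡ two≉0 (begin
        two * (m - (1# + s))       ≈⟨ solve 2 (λ M S → ⅱ :* (M :- (ı :+ S)) := (M :- ⅱ :* S) :- (ⅱ :- M)) refl m s ⟩
        (m - two * s) - (two - m)  ≈⟨ x≈y⇒x-y≈0 m-two*s≈two-m ⟩
        0#                         ≈⟨ zeroʳ two ⟨
        two * 0#                   ∎))

      pk-a≈a : pk a ≈ a
      pk-a≈a = begin
        s                                                                ≈⟨ solve 3 (λ M A S → S := A :- ((M :* (A :- ı) :- (A :* S :- ı)) :- (M :- (ı :+ S)) :* (A :- ı))) refl m a s ⟩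
        a - ((m * (a - 1#) - (a * s - 1#)) - (m - (1# + s)) * (a - 1#))  ≈⟨ +-congˡ (-‿cong (+-cong (x≈y⇒x-y≈0 m-geometric) (-‿cong (*-congʳ (x≈y⇒x-y≈0 m≈1+s))))) ⟩
        a - (0# - 0# * (a - 1#))                                         ≈⟨ solve 1 (λ A → A :- (con (0 , 0) :- con (0 , 0) :* (A :- ı)) := A) refl a ⟩
        a                                                                ∎

    pk-fixes-E : ∀ {a} → a ≉ 0# → a ≉ 1# → pk a ≈ a
    pk-fixes-E a≉0 a≉1 = AtPoint.pk-a≈a a≉0 a≉1

  collision-exists : ∀ {k} → 1 < k → k < n → Bézout.Identity 1 k n → two ≉ 0# → ∃₂ (Collision k)
  collision-exists {suc (suc j)} (ℕ.s≤s (ℕ.s≤s ℕ.z≤n)) k<n bézout two≉0 = decide (collision? (suc (suc j)))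
    where
    decide : Dec (∃₂ (Collision (suc (suc j)))) → ∃₂ (Collision (suc (suc j)))
    decide (yes collision) = collision
    decide (no  none)      = contradiction (nonzero-roots≤degree j roots) (ℕ.<⇒≱ (ℕ.<-trans (ℕ.n<1+n (suc j)) k<n))
      where
      open NoCollision (suc (suc j)) (pow-injective (suc j) bézout) two≉0 (λ c₁ c₂ c → none (c₁ , c₂ , c))
      roots : ∀ x → x ≉ 0# → pow x (suc j) ≈ 1#
      roots x x≉0 with x ≟ 1#
      ... | yes x≈1 = trans (pow-cong (suc j) x≈1) (pow-1# (suc j))
      ... | no  x≉1 = *-cancelˡ x≉0 (trans (pk-fixes-E x≉0 x≉1) (sym (*-identityʳ x)))

lemma8p2 : ∀ {c ℓ : Level} (p n q k : ℕ) → Prime p → p ≢ 2 → 0 < n → q ≡ p ^ n →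
           (F : FiniteField c ℓ q) → 1 < k → k < q ∸ 1 → gcd k (q ∸ 1) ≡ 1 →
           let open FiniteField F in
           ∃₂ λ c₁ c₂ → ¬ (c₁ ≈ 0#) × ¬ (c₁ ≈ 1#) × ¬ (c₂ ≈ 0#) × ¬ (c₂ ≈ 1#) ×
                        ¬ (c₁ ≈ c₂) × h k c₁ ≈ h k c₂
lemma8p2 p e zero    k _       _   _ _    F _   ()  _
lemma8p2 p e (suc n) k p-prime p≢2 _ q≡pᵉ F 1<k k<n gcd≡1 =
  collision-exists 1<k k<n (Bézout.identity (≡.subst (GCD k n) gcd≡1 (gcd-GCD k n))) (two≉0 (suc n / 2) n-even)
  where
  open FiniteFieldProperties F using (two≉0)
  open Collisions F using (collision-exists)
  n-even : n ≡ (suc n / 2) ℕ.* 2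
  n-even = odd⇒pred-even (≡.subst (λ q → q % 2 ≡ 1) (≡.sym q≡pᵉ) (^-odd e (odd-prime p-prime p≢2)))
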